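{- Let $G$ be an $\{\mathrm{ISK4},\mathrm{wheel}\}$-free trigraph, let $H$ be an inclusion-wise maximal induced subtrigraph of $G$ that is a thick complete bipartite trigraph, let $(A,B)$ be a bipartition of $H$, and let $v\in V(G)\setminus V(H)$. Then $v$ has at most one neighbor in $A$ and at most one neighbor in $B$.
   Context: A trigraph $G$ is a finite set $V(G)$ with a function $\theta_G$ from 2-element subsets to $\{ -1,0,1\}$; $uv$ is strongly adjacent if $\theta_G(uv)=1$, semi-adjacent if $0$, strongly anti-adjacent if $-1$, adjacent if $\ge0$ (then $u$ is a neighbor of $v$). A realization is a graph obtained by turning each semi-adjacent pair into an edge or non-edge. $G$ is $\{\mathrm{ISK4},\mathrm{wheel}\}$-free if no realization contains an induced subgraph isomorphic to a subdivision of $K_4$ or to a wheel (a chordless cycle plus a vertex with at least three neighbors on it). Induced subtrigraphs restrict $\theta_G$. A complete bipartite trigraph is a trigraph whose vertex set can be partitioned into two sets $A,B$ each of which is strongly stable (pairwise strongly anti-adjacent) with every vertex of $A$ strongly adjacent to every vertex of $B$; such $(A,B)$ is a bipartition. It is thick if $|A|,|B|\ge3$. -}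

module Defs where

open import Data.Nat using (ℕ; zero; suc; _≥_)
open import Data.Fin using (Fin; zero; suc; toℕ)
open import Data.Fin.Properties using (_≟_)
open import Data.Fin.Subset using (Subset; _∈_; _∉_; _⊆_; ∣_∣)
open import Data.Bool using (Bool; true; false; _∧_; _∨_; not)
open import Data.Product using (Σ; ∃; ∃-syntax; _×_; _,_)
open import Data.Sum using (_⊎_)
open import Data.Empty using (⊥)
open import Relation.Nullary using (¬_)
open import Relation.Nullary.Decidable using (⌊_⌋)
open import Relation.Binary.PropositionalEquality using (_≡_; _≢_)
open import Function.Definitions using (Injective)

-- θ values: strong = 1, semi = 0, anti = -1
data Adj : Set where
  strong semi anti : Adj

-- A trigraph on vertex set Fin n.  θ is only meaningful on pairs of
-- distinct vertices (2-element subsets); the diagonal is ignored.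
record Trigraph : Set where
  field
    n   : ℕ
    θ   : Fin n → Fin n → Adj
    sym : ∀ u v → θ u v ≡ θ v u
open Trigraph public

V : Trigraph → Set
V G = Fin (n G)

Adjacent : (G : Trigraph) → V G → V G → Set
Adjacent G u v = (u ≢ v) × (θ G u v ≢ anti)

StronglyAdjacent : (G : Trigraph) → V G → V G → Set
StronglyAdjacent G u v = θ G u v ≡ strong

StronglyAntiAdjacent : (G : Trigraph) → V G → V G → Set
StronglyAntiAdjacent G u v = θ G u v ≡ anti

record Realization (G : Trigraph) : Set where
  field
    E      : V G → V G → Bool
    E-sym  : ∀ u v → u ≢ v → E u v ≡ E v u
    E-str  : ∀ u v → u ≢ v → θ G u v ≡ strong → E u v ≡ true
    E-anti : ∀ u v → u ≢ v → θ G u v ≡ anti → E u v ≡ false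
open Realization public

record Graph : Set where
  field
    m  : ℕ
    GE : Fin m → Fin m → Bool
open Graph public

K4 : Graph
K4 = record { m = 4 ; GE = λ x y → not ⌊ x ≟ y ⌋ }

samePair : ∀ {k} → Fin k → Fin k → Fin k → Fin k → Bool
samePair x y u v = (⌊ x ≟ u ⌋ ∧ ⌊ y ≟ v ⌋) ∨ (⌊ x ≟ v ⌋ ∧ ⌊ y ≟ u ⌋)

-- subdivide the edge uv of H: new vertex `zero`, old vertices `suc x`
subdivide : (H : Graph) → Fin (m H) → Fin (m H) → Graph
subdivide H u v = record { m = suc (m H) ; GE = E' }
  where
  E' : Fin (suc (m H)) → Fin (suc (m H)) → Bool
  E' zero    zero    = false
  E' zero    (suc y) = ⌊ y ≟ u ⌋ ∨ ⌊ y ≟ v ⌋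
  E' (suc x) zero    = ⌊ x ≟ u ⌋ ∨ ⌊ x ≟ v ⌋
  E' (suc x) (suc y) = GE H x y ∧ not (samePair x y u v)

data SubdivisionOfK4 : Graph → Set where
  base : SubdivisionOfK4 K4
  step : ∀ H u v → GE H u v ≡ true → SubdivisionOfK4 H →
         SubdivisionOfK4 (subdivide H u v)

ContainsInduced : (G : Trigraph) → Realization G → Graph → Set
ContainsInduced G R H =
  Σ (Fin (m H) → V G) λ f → Injective _≡_ _≡_ f ×
    (∀ x y → x ≢ y → GE H x y ≡ E R (f x) (f y))

Succ : (k : ℕ) → Fin k → Fin k → Set
Succ k i j = (toℕ j ≡ suc (toℕ i)) ⊎ ((suc (toℕ i) ≡ k) × (toℕ j ≡ 0))

Consecutive : (k : ℕ) → Fin k → Fin k → Set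
Consecutive k i j = Succ k i j ⊎ Succ k j i

ContainsWheel : (G : Trigraph) → Realization G → Set
ContainsWheel G R =
  Σ ℕ λ k → (k ≥ 3) × Σ (Fin k → V G) λ c → Injective _≡_ _≡_ c ×
    (∀ i j → i ≢ j → (E R (c i) (c j) ≡ true → Consecutive k i j)
                   × (Consecutive k i j → E R (c i) (c j) ≡ true)) ×
    Σ (V G) λ x → (∀ i → x ≢ c i) ×
      Σ (Fin k) λ i₁ → Σ (Fin k) λ i₂ → Σ (Fin k) λ i₃ →
        (i₁ ≢ i₂) × (i₁ ≢ i₃) × (i₂ ≢ i₃) ×
        (E R x (c i₁) ≡ true) × (E R x (c i₂) ≡ true) × (E R x (c i₃) ≡ true)

ISK4WheelFree : Trigraph → Set
ISK4WheelFree G = (R : Realization G) →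
  (¬ Σ Graph λ H → SubdivisionOfK4 H × ContainsInduced G R H) ×
  (¬ ContainsWheel G R)

-- Induced subtrigraphs are given by their vertex sets S : Subset (n G).

StronglyStable : (G : Trigraph) → Subset (n G) → Set
StronglyStable G A = ∀ u v → u ∈ A → v ∈ A → u ≢ v → StronglyAntiAdjacent G u v

IsBipartition : (G : Trigraph) → Subset (n G) → Subset (n G) → Subset (n G) → Set
IsBipartition G S A B =
  (∀ x → x ∈ S → x ∈ A ⊎ x ∈ B) ×
  (A ⊆ S) × (B ⊆ S) ×
  (∀ x → x ∈ A → x ∈ B → ⊥) ×
  StronglyStable G A × StronglyStable G B ×
  (∀ a b → a ∈ A → b ∈ B → StronglyAdjacent G a b)

IsCompleteBipartite : (G : Trigraph) → Subset (n G) → Set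
IsCompleteBipartite G S = ∃[ A ] ∃[ B ] IsBipartition G S A B

IsThickCompleteBipartite : (G : Trigraph) → Subset (n G) → Set
IsThickCompleteBipartite G S =
  ∃[ A ] ∃[ B ] IsBipartition G S A B × (∣ A ∣ ≥ 3) × (∣ B ∣ ≥ 3)

IsMaximalThickCB : (G : Trigraph) → Subset (n G) → Set
IsMaximalThickCB G S =
  IsThickCompleteBipartite G S ×
  (∀ S' → S ⊆ S' → IsThickCompleteBipartite G S' → S' ⊆ S)

module Submission where

-- Suppose v has two neighbours a ≠ a′ in A
-- (the B-side follows by swapping the bipartition).
--   * If v also has a neighbour b ∈ B, then with any b′ ∈ B ∖ {b} the square
--     a–b–a′–b′ is a chordless 4-cycle in every realization, and v sees three
--     of its vertices once all semi-adjacent pairs are made edges: a wheel.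
--   * Otherwise v is strongly anti-adjacent to B.  If v were strongly adjacent
--     to all of A, then (A , B ∪ {v}) would be a thick bipartition of S ∪ {v},
--     contradicting maximality.  So some a₃ ∈ A is not strongly adjacent to v,
--     and (using |A| ≥ 3) we may take a, a′, a₃ pairwise distinct.  Making the
--     semi-edge v a₃ a non-edge, {a₃, v, a, a′, b₁, b₂} induces K4 on
--     {a, a′, b₁, b₂} with the edges aa′ and b₁b₂ subdivided (by v and a₃).  In
-- both forbidden configurations the adjacencies among the chosen vertices are
-- determined by their sides of the bipartition (for the ISK4: by their roles,
-- i.e. side and being an edge-neighbour of v, or being v); agreement with the
-- pattern graph (the 4-cycle, resp. the subdivided K4) is then a finite
-- computation discharged by a decision procedure.

open import Defs
open import Data.Bool using (Bool; true; false; not; _∧_)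
open import Data.Bool.Properties using (∧-comm)
import Data.Bool.Properties as Bool
open import Data.Empty using (⊥; ⊥-elim)
open import Data.Fin using (Fin; zero; suc; toℕ)
open import Data.Fin.Properties using (_≟_; any?; all?)
open import Data.Fin.Subset using (Subset; _∈_; _∉_; _⊆_; ∣_∣; _∪_; ⁅_⁆; inside; outside; Nonempty)
open import Data.Fin.Subset.Properties
  using (_∈?_; nonempty?; Empty-unique; ∣⊥∣≡0; p⊆q⇒∣p∣≤∣q∣; p⊆p∪q; q⊆p∪q; x∈p∪q⁻; x∈⁅x⁆; x∈⁅y⁆⇒x≡y; ∣⁅x⁆∣≡1)
open import Data.Nat using (suc; _+_; _≤_; z≤n; s≤s)
import Data.Nat as ℕ
import Data.Nat.Properties as ℕ
open import Data.Product using (∃; ∃₂; _×_; _,_; proj₁; proj₂)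
import Data.Product as Product
open import Data.Sum using (_⊎_; inj₁; inj₂)
import Data.Sum as Sum
open import Data.Vec using (Vec; []; _∷_; lookup)
open import Data.Vec.Relation.Unary.All using ([]; _∷_)
open import Data.Vec.Relation.Unary.AllPairs using ([]; _∷_)
open import Data.Vec.Relation.Unary.Unique.Propositional using (Unique)
open import Data.Vec.Relation.Unary.Unique.Propositional.Properties using (lookup-injective)
open import Function.Definitions using (Injective)
open import Relation.Nullary using (¬_; Dec; does; yes; no; contradiction)
open import Relation.Nullary.Decidable
  using (_×-dec_; _⊎-dec_; _→-dec_; ¬?; from-yes; decidable-stable; dec-true; dec-false)
import Relation.Binary.PropositionalEquality as ≡
open ≡ using (_≡_; _≢_; refl; trans; cong; cong₂; ≢-sym)

∣p∪q∣≤∣p∣+∣q∣ : ∀ {k} (p q : Subset k) → ∣ p ∪ q ∣ ≤ ∣ p ∣ + ∣ q ∣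
∣p∪q∣≤∣p∣+∣q∣ []            []            = z≤n
∣p∪q∣≤∣p∣+∣q∣ (outside ∷ p) (outside ∷ q) = ∣p∪q∣≤∣p∣+∣q∣ p q
∣p∪q∣≤∣p∣+∣q∣ (outside ∷ p) (inside ∷ q)  =
  ℕ.≤-trans (s≤s (∣p∪q∣≤∣p∣+∣q∣ p q)) (ℕ.≤-reflexive (≡.sym (ℕ.+-suc ∣ p ∣ ∣ q ∣)))
∣p∪q∣≤∣p∣+∣q∣ (inside ∷ p)  (outside ∷ q) = s≤s (∣p∪q∣≤∣p∣+∣q∣ p q)
∣p∪q∣≤∣p∣+∣q∣ (inside ∷ p)  (inside ∷ q)  =
  s≤s (ℕ.≤-trans (∣p∪q∣≤∣p∣+∣q∣ p q) (ℕ.+-monoʳ-≤ ∣ p ∣ (ℕ.n≤1+n ∣ q ∣)))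

-- A subset with at least three elements has an element other than x and y,
-- since otherwise it would lie inside {x} ∪ {y}, of size at most two.
avoid-two : ∀ {k} (p : Subset k) → 3 ≤ ∣ p ∣ → (x y : Fin k) →
            ∃ λ z → z ∈ p × z ≢ x × z ≢ y
avoid-two p |p|≥3 x y with any? (λ z → z ∈? p ×-dec ¬? (z ≟ x) ×-dec ¬? (z ≟ y))
... | yes found = found
... | no none = contradiction (ℕ.≤-trans |p|≥3 |p|≤2) λ { (s≤s (s≤s ())) }
  where
  p⊆xy : p ⊆ ⁅ x ⁆ ∪ ⁅ y ⁆
  p⊆xy {z} z∈p with z ≟ x | z ≟ y
  ... | yes refl | _      = p⊆p∪q ⁅ y ⁆ (x∈⁅x⁆ z)
  ... | no _     | yes refl = q⊆p∪q ⁅ x ⁆ ⁅ y ⁆ (x∈⁅x⁆ z)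
  ... | no z≢x   | no z≢y = contradiction (z , z∈p , z≢x , z≢y) none
  |p|≤2 : ∣ p ∣ ≤ 2
  |p|≤2 = ℕ.≤-trans (p⊆q⇒∣p∣≤∣q∣ p⊆xy)
           (ℕ.≤-trans (∣p∪q∣≤∣p∣+∣q∣ ⁅ x ⁆ ⁅ y ⁆)
             (ℕ.≤-reflexive (cong₂ _+_ (∣⁅x⁆∣≡1 x) (∣⁅x⁆∣≡1 y))))

element : ∀ {k} (p : Subset k) → 1 ≤ ∣ p ∣ → Nonempty p
element {k} p |p|≥1 with nonempty? p
... | yes found = found
... | no empty  = contradiction (trans (cong ∣_∣ (Empty-unique empty)) (∣⊥∣≡0 k))
                               (≢-sym (ℕ.<⇒≢ |p|≥1))

two-elements : ∀ {k} (p : Subset k) → 3 ≤ ∣ p ∣ → ∃₂ λ x y → x ∈ p × y ∈ p × x ≢ y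
two-elements p |p|≥3 with element p (ℕ.≤-trans (s≤s z≤n) |p|≥3)
... | x , x∈p with avoid-two p |p|≥3 x x
... | y , y∈p , y≢x , _ = x , y , x∈p , y∈p , λ x≡y → y≢x (≡.sym x≡y)

strong? : (t : Adj) → Dec (t ≡ strong)
strong? strong = yes refl
strong? semi   = no λ ()
strong? anti   = no λ ()

anti? : (t : Adj) → Dec (t ≡ anti)
anti? strong = no λ ()
anti? semi   = no λ ()
anti? anti   = yes refl

strong≢anti : strong ≢ anti
strong≢anti ()

resolve : Adj → Bool → Bool
resolve strong _ = true
resolve semi   c = c
resolve anti   _ = false

resolve-adjacent : ∀ t → t ≢ anti → resolve t true ≡ true
resolve-adjacent strong _ = refl
resolve-adjacent semi   _ = refl
resolve-adjacent anti   t≢anti = contradiction refl t≢anti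

resolve-nonstrong : ∀ t → t ≢ strong → resolve t false ≡ false
resolve-nonstrong strong t≢strong = contradiction refl t≢strong
resolve-nonstrong semi   _ = refl
resolve-nonstrong anti   _ = refl

realizeBy : (G : Trigraph) (choose : V G → V G → Bool) →
            (∀ u w → choose u w ≡ choose w u) → Realization G
realizeBy G choose choose-sym = record
  { E      = λ u w → resolve (θ G u w) (choose u w)
  ; E-sym  = λ u w _ → cong₂ resolve (sym G u w) (choose-sym u w)
  ; E-str  = λ u w _ θ≡strong → cong (λ t → resolve t (choose u w)) θ≡strong
  ; E-anti = λ u w _ θ≡anti → cong (λ t → resolve t (choose u w)) θ≡anti
  }

full : (G : Trigraph) → Realization G
full G = realizeBy G (λ _ _ → true) (λ _ _ → refl)

avoiding : (G : Trigraph) → V G → Realization G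
avoiding G x = realizeBy G (λ u w → not (does (u ≟ x)) ∧ not (does (w ≟ x)))
                           (λ u w → ∧-comm (not (does (u ≟ x))) (not (does (w ≟ x))))

avoiding-away : ∀ G {x u w} → u ≢ x → w ≢ x → E (avoiding G x) u w ≡ resolve (θ G u w) true
avoiding-away G {x} {u} {w} u≢x w≢x
  rewrite dec-false (u ≟ x) u≢x | dec-false (w ≟ x) w≢x = refl

avoiding-at : ∀ G {x u} → u ≢ x → E (avoiding G x) u x ≡ resolve (θ G u x) false
avoiding-at G {x} {u} u≢x rewrite dec-false (u ≟ x) u≢x | dec-true (x ≟ x) refl = refl

succ? : ∀ k (i j : Fin k) → Dec (Succ k i j)
succ? k i j = (toℕ j ℕ.≟ suc (toℕ i)) ⊎-dec ((suc (toℕ i) ℕ.≟ k) ×-dec (toℕ j ℕ.≟ 0))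

consecutive? : ∀ k (i j : Fin k) → Dec (Consecutive k i j)
consecutive? k i j = succ? k i j ⊎-dec succ? k j i

data Side : Set where
  left right : Side

across : Side → Side → Bool
across left  right = true
across right left  = true
across _     _     = false

module Bipartition (G : Trigraph) (S A B : Subset (n G)) (bip : IsBipartition G S A B) where

  covers : ∀ x → x ∈ S → x ∈ A ⊎ x ∈ B
  covers = proj₁ bip

  A⊆S : A ⊆ S
  A⊆S = proj₁ (proj₂ bip)

  B⊆S : B ⊆ S
  B⊆S = proj₁ (proj₂ (proj₂ bip))

  disjoint : ∀ x → x ∈ A → x ∈ B → ⊥
  disjoint = proj₁ (proj₂ (proj₂ (proj₂ bip)))

  A-stable : StronglyStable G A
  A-stable = proj₁ (proj₂ (proj₂ (proj₂ (proj₂ bip))))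

  B-stable : StronglyStable G B
  B-stable = proj₁ (proj₂ (proj₂ (proj₂ (proj₂ (proj₂ bip)))))

  complete : ∀ a b → a ∈ A → b ∈ B → StronglyAdjacent G a b
  complete = proj₂ (proj₂ (proj₂ (proj₂ (proj₂ (proj₂ bip)))))

  part : Side → Subset (n G)
  part left  = A
  part right = B

  part⊆S : ∀ s → part s ⊆ S
  part⊆S left  = A⊆S
  part⊆S right = B⊆S

  A≢B : ∀ {x y} → x ∈ A → y ∈ B → x ≢ y
  A≢B x∈A y∈B refl = disjoint _ x∈A y∈B

  side-unique : ∀ {s t u} → u ∈ part s → u ∈ part t → s ≡ t
  side-unique {left}  {left}  _   _   = refl
  side-unique {left}  {right} u∈A u∈B = ⊥-elim (disjoint _ u∈A u∈B)
  side-unique {right} {left}  u∈B u∈A = ⊥-elim (disjoint _ u∈A u∈B)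
  side-unique {right} {right} _   _   = refl

  edge-between : ∀ (R : Realization G) {s t u w} → u ∈ part s → w ∈ part t → u ≢ w →
                 E R u w ≡ across s t
  edge-between R {left}  {left}  {u} {w} u∈A w∈A u≢w = E-anti R u w u≢w (A-stable u w u∈A w∈A u≢w)
  edge-between R {left}  {right} {u} {w} u∈A w∈B u≢w = E-str R u w u≢w (complete u w u∈A w∈B)
  edge-between R {right} {left}  {u} {w} u∈B w∈A u≢w =
    E-str R u w u≢w (trans (sym G u w) (complete w u w∈A u∈B))
  edge-between R {right} {right} {u} {w} u∈B w∈B u≢w = E-anti R u w u≢w (B-stable u w u∈B w∈B u≢w)

swap : ∀ {G S A B} → IsBipartition G S A B → IsBipartition G S B A
swap {G} (covers , A⊆S , B⊆S , disjoint , A-stable , B-stable , complete) =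
  (λ x x∈S → Sum.swap (covers x x∈S)) , B⊆S , A⊆S , (λ x x∈B x∈A → disjoint x x∈A x∈B) ,
  B-stable , A-stable , (λ b a b∈B a∈A → trans (sym G b a) (complete a b a∈A b∈B))

-- Two bipartitions of the same vertex set that share a vertex on their first
-- sides agree: a vertex switching sides would be both strongly adjacent and
-- strongly anti-adjacent to that shared vertex.
aligned : ∀ G S {A₀ B₀ A B x} → IsBipartition G S A₀ B₀ → IsBipartition G S A B →
          x ∈ A₀ → x ∈ A → (A₀ ⊆ A) × (B₀ ⊆ B)
aligned G S {A₀} {B₀} {A} {B} {x} bip₀ bip x∈A₀ x∈A = A₀⊆A , B₀⊆B
  where
  module P₀ = Bipartition G S A₀ B₀ bip₀
  module P = Bipartition G S A B bip
  A₀⊆A : A₀ ⊆ A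
  A₀⊆A {z} z∈A₀ with P.covers z (P₀.A⊆S z∈A₀) | z ≟ x
  ... | inj₁ z∈A | _     = z∈A
  ... | inj₂ z∈B | yes refl = ⊥-elim (P.disjoint z x∈A z∈B)
  ... | inj₂ z∈B | no z≢x =
    ⊥-elim (strong≢anti (trans (≡.sym (P.complete x z x∈A z∈B))
                          (trans (sym G x z) (P₀.A-stable z x z∈A₀ x∈A₀ z≢x))))
  B₀⊆B : B₀ ⊆ B
  B₀⊆B {z} z∈B₀ with P.covers z (P₀.B⊆S z∈B₀) | z ≟ x
  ... | inj₂ z∈B | _     = z∈B
  ... | inj₁ z∈A | yes refl = ⊥-elim (P₀.disjoint z x∈A₀ z∈B₀)
  ... | inj₁ z∈A | no z≢x =
    ⊥-elim (strong≢anti (trans (≡.sym (P₀.complete x z x∈A₀ z∈B₀))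
                          (trans (sym G x z) (P.A-stable z x z∈A x∈A z≢x))))

grow : ∀ {k} {p q : Subset k} → 3 ≤ ∣ p ∣ → p ⊆ q → 3 ≤ ∣ q ∣
grow |p|≥3 p⊆q = ℕ.≤-trans |p|≥3 (p⊆q⇒∣p∣≤∣q∣ p⊆q)

-- Thickness is a property of S: every bipartition of a thick complete
-- bipartite trigraph has two sides of size at least three.
thick-parts : ∀ G S A B → IsThickCompleteBipartite G S → IsBipartition G S A B →
              (3 ≤ ∣ A ∣) × (3 ≤ ∣ B ∣)
thick-parts G S A B (A₀ , B₀ , bip₀ , |A₀|≥3 , |B₀|≥3) bip
  with element A₀ (ℕ.≤-trans (s≤s z≤n) |A₀|≥3)
... | x , x∈A₀ with Bipartition.covers G S A B bip x (Bipartition.A⊆S G S A₀ B₀ bip₀ x∈A₀)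
... | inj₁ x∈A = Product.map (grow |A₀|≥3) (grow |B₀|≥3) (aligned G S bip₀ bip x∈A₀ x∈A)
... | inj₂ x∈B = Product.swap (Product.map (grow |A₀|≥3) (grow |B₀|≥3) (aligned G S bip₀ (swap {G} {S} {A} {B} bip) x∈A₀ x∈B))

∈-∪⁅⁆ : ∀ {k} {p : Subset k} {v x} → x ∈ p ∪ ⁅ v ⁆ → x ∈ p ⊎ x ≡ v
∈-∪⁅⁆ {p = p} {v} x∈ = Sum.map₂ (x∈⁅y⁆⇒x≡y v) (x∈p∪q⁻ p ⁅ v ⁆ x∈)

extend : ∀ G S A B {v} → IsBipartition G S A B → v ∉ S →
         (∀ a → a ∈ A → θ G v a ≡ strong) → (∀ b → b ∈ B → θ G v b ≡ anti) →
         IsBipartition G (S ∪ ⁅ v ⁆) A (B ∪ ⁅ v ⁆)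
extend G S A B {v} bip v∉S v-A v-B =
  covers′ , (λ a∈A → p⊆p∪q ⁅ v ⁆ (A⊆S a∈A)) , B′⊆S′ , disjoint′ , A-stable , B′-stable , complete′
  where
  open Bipartition G S A B bip
  v∈ : ∀ p → v ∈ p ∪ ⁅ v ⁆
  v∈ p = q⊆p∪q p ⁅ v ⁆ (x∈⁅x⁆ v)
  covers′ : ∀ x → x ∈ S ∪ ⁅ v ⁆ → x ∈ A ⊎ x ∈ B ∪ ⁅ v ⁆
  covers′ x x∈ with ∈-∪⁅⁆ x∈
  ... | inj₁ x∈S = Sum.map₂ (p⊆p∪q ⁅ v ⁆) (covers x x∈S)
  ... | inj₂ refl = inj₂ (v∈ B)
  B′⊆S′ : B ∪ ⁅ v ⁆ ⊆ S ∪ ⁅ v ⁆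
  B′⊆S′ x∈ with ∈-∪⁅⁆ x∈
  ... | inj₁ x∈B = p⊆p∪q ⁅ v ⁆ (B⊆S x∈B)
  ... | inj₂ refl = v∈ S
  disjoint′ : ∀ x → x ∈ A → x ∈ B ∪ ⁅ v ⁆ → ⊥
  disjoint′ x x∈A x∈ with ∈-∪⁅⁆ x∈
  ... | inj₁ x∈B = disjoint x x∈A x∈B
  ... | inj₂ refl = v∉S (A⊆S x∈A)
  B′-stable : StronglyStable G (B ∪ ⁅ v ⁆)
  B′-stable u w u∈ w∈ u≢w with ∈-∪⁅⁆ u∈ | ∈-∪⁅⁆ w∈
  ... | inj₁ u∈B | inj₁ w∈B = B-stable u w u∈B w∈B u≢w
  ... | inj₁ u∈B | inj₂ refl = trans (sym G u v) (v-B u u∈B)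
  ... | inj₂ refl | inj₁ w∈B = v-B w w∈B
  ... | inj₂ refl | inj₂ refl = contradiction refl u≢w
  complete′ : ∀ a b → a ∈ A → b ∈ B ∪ ⁅ v ⁆ → StronglyAdjacent G a b
  complete′ a b a∈A b∈ with ∈-∪⁅⁆ b∈
  ... | inj₁ b∈B = complete a b a∈A b∈B
  ... | inj₂ refl = trans (sym G a v) (v-A a a∈A)

square-sides : Vec Side 4
square-sides = left ∷ right ∷ left ∷ right ∷ []

square-alternates : ∀ i j → i ≢ j →
  (across (lookup square-sides i) (lookup square-sides j) ≡ true → Consecutive 4 i j) ×
  (Consecutive 4 i j → across (lookup square-sides i) (lookup square-sides j) ≡ true)
square-alternates = from-yes (all? λ i → all? λ j → ¬? (i ≟ j) →-dec
  (((across (lookup square-sides i) (lookup square-sides j) Bool.≟ true) →-dec consecutive? 4 i j) ×-dec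
   (consecutive? 4 i j →-dec (across (lookup square-sides i) (lookup square-sides j) Bool.≟ true))))

-- Roles of the vertices of the ISK4 relative to v: v itself, or a vertex on
-- a given side of the bipartition that is (or is not) an edge-neighbour of v.
data Role : Set where
  hub    : Role
  member : Side → Bool → Role

linked : Role → Role → Bool
linked hub          hub          = false
linked hub          (member _ e) = e
linked (member _ e) hub          = e
linked (member s _) (member t _) = across s t

-- K4 with two disjoint edges subdivided: positions 0 and 1 are the
-- subdivision vertices, 2 3 4 5 are the original vertices, 1 subdivides 23
-- and 0 subdivides 45.
subdivided-K4 : Graph
subdivided-K4 = subdivide (subdivide K4 zero (suc zero)) (suc (suc (suc zero))) (suc (suc (suc (suc zero))))

subdivided-K4-is-ISK4 : SubdivisionOfK4 subdivided-K4
subdivided-K4-is-ISK4 = step _ _ _ refl (step K4 _ _ refl base)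

-- Roles realising subdivided-K4: 0 = a₃ ∈ A (not a neighbour of v),
-- 1 = v, 2 3 = a a′ ∈ A (neighbours of v), 4 5 = b₁ b₂ ∈ B.
subdivided-K4-roles : Vec Role 6
subdivided-K4-roles =
  member left false ∷ hub ∷ member left true ∷ member left true ∷ member right false ∷ member right false ∷ []

subdivided-K4-by-roles : ∀ i j → i ≢ j →
  GE subdivided-K4 i j ≡ linked (lookup subdivided-K4-roles i) (lookup subdivided-K4-roles j)
subdivided-K4-by-roles = from-yes (all? λ i → all? λ j → ¬? (i ≟ j) →-dec
  (GE subdivided-K4 i j Bool.≟ linked (lookup subdivided-K4-roles i) (lookup subdivided-K4-roles j)))

module Roles (G : Trigraph) (S A B : Subset (n G)) (bip : IsBipartition G S A B)
             (v : V G) (v∉S : v ∉ S) where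
  open Bipartition G S A B bip

  outside-S : ∀ {u} → u ∈ S → v ≢ u
  outside-S u∈S refl = v∉S u∈S

  strongly-adjacent : ∀ {u} → u ∈ S → θ G v u ≡ strong → Adjacent G v u
  strongly-adjacent u∈S v-u = outside-S u∈S , λ v-u-anti → strong≢anti (trans (≡.sym v-u) v-u-anti)

  HasRole : Realization G → Role → V G → Set
  HasRole R hub          u = u ≡ v
  HasRole R (member s e) u = u ∈ part s × E R v u ≡ e

  edge-by-role : ∀ R {r r′ u w} → HasRole R r u → HasRole R r′ w → u ≢ w → E R u w ≡ linked r r′
  edge-by-role R {hub}        {hub}        refl refl        u≢w = contradiction refl u≢w
  edge-by-role R {hub}        {member _ _} refl (_ , v-w)   _   = v-w
  edge-by-role R {member _ _} {hub}        (_ , v-u) refl   u≢v = trans (E-sym R _ v u≢v) v-u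
  edge-by-role R {member _ _} {member _ _} (u∈s , _) (w∈t , _) u≢w = edge-between R u∈s w∈t u≢w

  role-unique : ∀ R {r r′ u} → HasRole R r u → HasRole R r′ u → r ≡ r′
  role-unique R {hub}        {hub}        _ _ = refl
  role-unique R {hub}        {member s _} refl (v∈s , _) = ⊥-elim (v∉S (part⊆S s v∈s))
  role-unique R {member s _} {hub}        (v∈s , _) refl = ⊥-elim (v∉S (part⊆S s v∈s))
  role-unique R {member _ _} {member _ _} (u∈s , v-u) (u∈t , v-u′) =
    cong₂ member (side-unique u∈s u∈t) (trans (≡.sym v-u) v-u′)

  apart : ∀ R {r r′ u w} → HasRole R r u → HasRole R r′ w → r ≢ r′ → u ≢ w
  apart R u-plays w-plays r≢r′ refl = r≢r′ (role-unique R u-plays w-plays)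

  induced-by-roles : ∀ R (H : Graph) (roles : Vec Role (m H)) (xs : Vec (V G) (m H)) → Unique xs →
    (∀ i → HasRole R (lookup roles i) (lookup xs i)) →
    (∀ i j → i ≢ j → GE H i j ≡ linked (lookup roles i) (lookup roles j)) →
    ContainsInduced G R H
  induced-by-roles R H roles xs distinct plays predicted = lookup xs , injective , edges
    where
    injective : Injective _≡_ _≡_ (lookup xs)
    injective {i} {j} = lookup-injective distinct i j
    edges : ∀ i j → i ≢ j → GE H i j ≡ E R (lookup xs i) (lookup xs j)
    edges i j i≢j = trans (predicted i j i≢j)
      (≡.sym (edge-by-role R (plays i) (plays j) (λ xᵢ≡xⱼ → i≢j (injective xᵢ≡xⱼ))))

module Forbidden (G : Trigraph) (free : ISK4WheelFree G) (S A B : Subset (n G))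
                 (bip : IsBipartition G S A B) (|A|≥3 : 3 ≤ ∣ A ∣) (|B|≥3 : 3 ≤ ∣ B ∣)
                 (v : V G) (v∉S : v ∉ S) where
  open Bipartition G S A B bip
  open Roles G S A B bip v v∉S

  -- Neighbours of v in A and in B, together with a second vertex of B, give
  -- a wheel: the square a₁ b a₂ b′ with hub v.
  no-wheel : ∀ {a₁ a₂ b} → a₁ ≢ a₂ → a₁ ∈ A → a₂ ∈ A → b ∈ B →
             Adjacent G v a₁ → Adjacent G v a₂ → Adjacent G v b → ⊥
  no-wheel {a₁} {a₂} {b} a₁≢a₂ a₁∈A a₂∈A b∈B v-a₁ v-a₂ v-b with avoid-two B |B|≥3 b b
  ... | b′ , b′∈B , b′≢b , _ =
    proj₂ (free R) (4 , s≤s (s≤s (s≤s z≤n)) , lookup square , injective , chordless , v , off-square ,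
                    zero , suc (suc zero) , suc zero , (λ ()) , (λ ()) , (λ ()) ,
                    hub-edge v-a₁ , hub-edge v-a₂ , hub-edge v-b)
    where
    R : Realization G
    R = full G
    square : Vec (V G) 4
    square = a₁ ∷ b ∷ a₂ ∷ b′ ∷ []
    on-side : ∀ i → lookup square i ∈ part (lookup square-sides i)
    on-side zero                   = a₁∈A
    on-side (suc zero)             = b∈B
    on-side (suc (suc zero))       = a₂∈A
    on-side (suc (suc (suc zero))) = b′∈B
    distinct : Unique square
    distinct = (A≢B a₁∈A b∈B ∷ a₁≢a₂ ∷ A≢B a₁∈A b′∈B ∷ []) ∷
               ((λ b≡a₂ → A≢B a₂∈A b∈B (≡.sym b≡a₂)) ∷ (λ b≡b′ → b′≢b (≡.sym b≡b′)) ∷ []) ∷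
               (A≢B a₂∈A b′∈B ∷ []) ∷ [] ∷ []
    injective : Injective _≡_ _≡_ (lookup square)
    injective {i} {j} = lookup-injective distinct i j
    chordless : ∀ i j → i ≢ j → (E R (lookup square i) (lookup square j) ≡ true → Consecutive 4 i j) ×
                                 (Consecutive 4 i j → E R (lookup square i) (lookup square j) ≡ true)
    chordless i j i≢j =
      (λ edge → proj₁ (square-alternates i j i≢j) (trans (≡.sym by-sides) edge)) ,
      (λ consecutive → trans by-sides (proj₂ (square-alternates i j i≢j) consecutive))
      where
      by-sides : E R (lookup square i) (lookup square j) ≡ across (lookup square-sides i) (lookup square-sides j)
      by-sides = edge-between R (on-side i) (on-side j) (λ eq → i≢j (injective eq))
    off-square : ∀ i → v ≢ lookup square i
    off-square i = outside-S (part⊆S _ (on-side i))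
    hub-edge : ∀ {u} → Adjacent G v u → E R v u ≡ true
    hub-edge (_ , v-u) = resolve-adjacent _ v-u

  module AvoidingRoles {a₃ : V G} (a₃∈A : a₃ ∈ A) where
    R : Realization G
    R = avoiding G a₃

    v≢a₃ : v ≢ a₃
    v≢a₃ = outside-S (A⊆S a₃∈A)

    neighbour : ∀ {u} → u ∈ A → u ≢ a₃ → Adjacent G v u → HasRole R (member left true) u
    neighbour u∈A u≢a₃ (_ , v-u) = u∈A , trans (avoiding-away G v≢a₃ u≢a₃) (resolve-adjacent _ v-u)

    avoided : θ G v a₃ ≢ strong → HasRole R (member left false) a₃
    avoided v-a₃ = a₃∈A , trans (avoiding-at G v≢a₃) (resolve-nonstrong _ v-a₃)

    opposite : ∀ {b} → b ∈ B → θ G v b ≡ anti → HasRole R (member right false) b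
    opposite b∈B v-b = b∈B , E-anti R v _ (outside-S (B⊆S b∈B)) v-b

  no-ISK4-distinct : ∀ {a a′ a₃} → a ≢ a′ → a ≢ a₃ → a′ ≢ a₃ →
            a ∈ A → a′ ∈ A → a₃ ∈ A → Adjacent G v a → Adjacent G v a′ → θ G v a₃ ≢ strong →
            (∀ b → b ∈ B → θ G v b ≡ anti) → ⊥
  no-ISK4-distinct {a} {a′} {a₃} a≢a′ a≢a₃ a′≢a₃ a∈A a′∈A a₃∈A v-a v-a′ v-a₃ v-B
    with two-elements B |B|≥3
  ... | b₁ , b₂ , b₁∈B , b₂∈B , b₁≢b₂ =
    proj₁ (free R) (subdivided-K4 , subdivided-K4-is-ISK4 ,
                    induced-by-roles R subdivided-K4 subdivided-K4-roles xs distinct plays subdivided-K4-by-roles)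
    where
    open AvoidingRoles a₃∈A
    xs : Vec (V G) 6
    xs = a₃ ∷ v ∷ a ∷ a′ ∷ b₁ ∷ b₂ ∷ []
    a₃-role : HasRole R (member left false) a₃
    a₃-role = avoided v-a₃
    v-role : HasRole R hub v
    v-role = refl
    a-role : HasRole R (member left true) a
    a-role = neighbour a∈A a≢a₃ v-a
    a′-role : HasRole R (member left true) a′
    a′-role = neighbour a′∈A a′≢a₃ v-a′
    b₁-role : HasRole R (member right false) b₁
    b₁-role = opposite b₁∈B (v-B b₁ b₁∈B)
    b₂-role : HasRole R (member right false) b₂
    b₂-role = opposite b₂∈B (v-B b₂ b₂∈B)
    plays : ∀ i → HasRole R (lookup subdivided-K4-roles i) (lookup xs i)
    plays zero                               = a₃-role
    plays (suc zero)                         = v-role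
    plays (suc (suc zero))                   = a-role
    plays (suc (suc (suc zero)))             = a′-role
    plays (suc (suc (suc (suc zero))))       = b₁-role
    plays (suc (suc (suc (suc (suc zero))))) = b₂-role
    distinct : Unique xs
    distinct =
      (apart R a₃-role v-role (λ ()) ∷ apart R a₃-role a-role (λ ()) ∷ apart R a₃-role a′-role (λ ()) ∷
       apart R a₃-role b₁-role (λ ()) ∷ apart R a₃-role b₂-role (λ ()) ∷ []) ∷
      (apart R v-role a-role (λ ()) ∷ apart R v-role a′-role (λ ()) ∷
       apart R v-role b₁-role (λ ()) ∷ apart R v-role b₂-role (λ ()) ∷ []) ∷
      (a≢a′ ∷ apart R a-role b₁-role (λ ()) ∷ apart R a-role b₂-role (λ ()) ∷ []) ∷
      (apart R a′-role b₁-role (λ ()) ∷ apart R a′-role b₂-role (λ ()) ∷ []) ∷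
      (b₁≢b₂ ∷ []) ∷ [] ∷ []

  -- The same from two neighbours a a′ of v in A and any x ∈ A not strongly
  -- adjacent to v: with a third vertex z of A, one of the triples
  -- (a, a′, z), (a′, z, a), (a, z, a′), (a, a′, x) is pairwise distinct with
  -- its last vertex not strongly adjacent to v and the others neighbours of v.
  no-ISK4 : ∀ {a a′ x} → a ≢ a′ → a ∈ A → a′ ∈ A → x ∈ A →
             Adjacent G v a → Adjacent G v a′ → θ G v x ≢ strong → (∀ b → b ∈ B → θ G v b ≡ anti) → ⊥
  no-ISK4 {a} {a′} {x} a≢a′ a∈A a′∈A x∈A v-a v-a′ v-x v-B with avoid-two A |A|≥3 a a′
  ... | z , z∈A , z≢a , z≢a′ with strong? (θ G v z)
  ... | no v-z = no-ISK4-distinct a≢a′ (≢-sym z≢a) (≢-sym z≢a′) a∈A a′∈A z∈A v-a v-a′ v-z v-B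
  ... | yes v-z with x ≟ a | x ≟ a′
  ... | yes refl | _ =
    no-ISK4-distinct (≢-sym z≢a′) (≢-sym a≢a′) z≢a a′∈A z∈A x∈A v-a′ (strongly-adjacent (A⊆S z∈A) v-z) v-x v-B
  ... | no _ | yes refl =
    no-ISK4-distinct (≢-sym z≢a) a≢a′ z≢a′ a∈A z∈A x∈A v-a (strongly-adjacent (A⊆S z∈A) v-z) v-x v-B
  ... | no x≢a | no x≢a′ =
    no-ISK4-distinct a≢a′ (≢-sym x≢a) (≢-sym x≢a′) a∈A a′∈A x∈A v-a v-a′ v-x v-B

  not-maximal : IsMaximalThickCB G S → (∀ a → a ∈ A → θ G v a ≡ strong) →
                (∀ b → b ∈ B → θ G v b ≡ anti) → ⊥
  not-maximal (_ , maximal) v-A v-B =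
    v∉S (maximal (S ∪ ⁅ v ⁆) (p⊆p∪q ⁅ v ⁆)
                 (A , B ∪ ⁅ v ⁆ , extend G S A B bip v∉S v-A v-B , |A|≥3 , grow {p = B} |B|≥3 (p⊆p∪q ⁅ v ⁆))
                 (q⊆p∪q S ⁅ v ⁆ (x∈⁅x⁆ v)))

  constant-on : ∀ X t → (∀ s → Dec (s ≡ t)) → ¬ (∃ λ x → x ∈ X × θ G v x ≢ t) →
                ∀ x → x ∈ X → θ G v x ≡ t
  constant-on X t t? no-exception x x∈X =
    decidable-stable (t? (θ G v x)) λ v-x → no-exception (x , x∈X , v-x)

  -- If v is strongly anticomplete to B, it has no two neighbours in A: either
  -- some vertex of A is not strongly adjacent to v, giving an ISK4, or v is
  -- strongly complete to A, contradicting maximality.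
  anticomplete-to-B : IsMaximalThickCB G S → ∀ {a a′} → a ≢ a′ → a ∈ A → a′ ∈ A →
    Adjacent G v a → Adjacent G v a′ → (∀ b → b ∈ B → θ G v b ≡ anti) → ⊥
  anticomplete-to-B max a≢a′ a∈A a′∈A v-a v-a′ v-B with any? (λ x → x ∈? A ×-dec ¬? (strong? (θ G v x)))
  ... | yes (x , x∈A , v-x) = no-ISK4 a≢a′ a∈A a′∈A x∈A v-a v-a′ v-x v-B
  ... | no all-strong = not-maximal max (constant-on A strong strong? all-strong) v-B

  one-neighbour-in-A : IsMaximalThickCB G S →
    ∀ a a′ → a ∈ A → a′ ∈ A → Adjacent G v a → Adjacent G v a′ → a ≡ a′
  one-neighbour-in-A max a a′ a∈A a′∈A v-a v-a′ with a ≟ a′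
  ... | yes a≡a′ = a≡a′
  ... | no a≢a′ with any? (λ b → b ∈? B ×-dec ¬? (anti? (θ G v b)))
  ... | yes (b , b∈B , v-b) = ⊥-elim (no-wheel a≢a′ a∈A a′∈A b∈B v-a v-a′ (outside-S (B⊆S b∈B) , v-b))
  ... | no no-B-neighbour =
    ⊥-elim (anticomplete-to-B max a≢a′ a∈A a′∈A v-a v-a′ (constant-on B anti anti? no-B-neighbour))

proposition4p16 : (G : Trigraph) → ISK4WheelFree G →
    (S : Subset (n G)) → IsMaximalThickCB G S →
    (A B : Subset (n G)) → IsBipartition G S A B →
    (v : V G) → v ∉ S →
    (∀ a a′ → a ∈ A → a′ ∈ A → Adjacent G v a → Adjacent G v a′ → a ≡ a′) ×
    (∀ b b′ → b ∈ B → b′ ∈ B → Adjacent G v b → Adjacent G v b′ → b ≡ b′)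
proposition4p16 G free S max A B bip v v∉S with thick-parts G S A B (proj₁ max) bip
... | |A|≥3 , |B|≥3 =
  Forbidden.one-neighbour-in-A G free S A B bip |A|≥3 |B|≥3 v v∉S max ,
  Forbidden.one-neighbour-in-A G free S B A (swap {G} {S} {A} {B} bip) |B|≥3 |A|≥3 v v∉S max
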